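{- Let $\ell\in\mathbb{N}$, let $h\in\mathbb{Z}[x_1,\dots,x_\ell]$ be intersective with a fixed choice of $p$-adic integer roots $\{\mathbf{z}_p\}$, let $d,q\in\mathbb{N}$ and $A\subseteq\mathbb{N}$. If $(A-A)\cap h_d(\mathbb{Z}^\ell)\subseteq\{0\}$ and $A'\subseteq\{a : x+\lambda(q)a\in A\}$ for some $x\in\mathbb{Z}$, then $(A'-A')\cap h_{qd}(\mathbb{Z}^\ell)\subseteq\{0\}$.
   Context: $h$ is intersective if $h\not\equiv0$ and has a root $\mathbf{z}_p\in\mathbb{Z}_p^\ell$ for every prime $p$. Given the choice $\{\mathbf{z}_p\}$: $m_p=\min\{|\mathbf{i}|:\partial^{\mathbf{i}}h(\mathbf{z}_p)\ne0\}$; $\lambda$ is the completely multiplicative function with $\lambda(p)=p^{m_p}$; for $d\in\mathbb{N}$, $\mathbf{r}_d\in(-d,0]^\ell\cap\mathbb{Z}^\ell$ is the unique vector with $\mathbf{r}_d\equiv\mathbf{z}_p\bmod p^j$ for all prime powers $p^j\mid d$; $h_d(\mathbf{x})=h(\mathbf{r}_d+d\mathbf{x})/\lambda(d)$. -}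

module Defs where

open import Data.Nat as ℕ using (ℕ; zero; suc)
open import Data.Integer as ℤ using (ℤ; +_; _-_)
open import Data.Integer.Divisibility using (_∣_)
open import Data.Nat.Primality using (Prime)
open import Data.List using (List; []; _∷_; map; foldr)
open import Data.Vec as Vec using (Vec; []; _∷_)
open import Data.Product using (Σ; ∃; _×_; _,_)
open import Data.List.Relation.Unary.All using (All)
import Data.Vec.Relation.Unary.All as VAll
import Data.Nat.Divisibility as ℕD
open import Data.Product using (proj₁; proj₂)
open import Relation.Binary.PropositionalEquality using (_≡_)
open import Relation.Nullary using (¬_)
open import Function using (_∘_)

-- Multivariate integer polynomials in ℓ variables x₁,…,x_ℓ, represented
-- recursively: Poly 0 = ℤ, and an element of Poly (suc ℓ) is the list of
-- coefficients [c₀, c₁, …] (each in Poly ℓ, in x₂,…,x_{ℓ+1}) of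
-- Σ_k c_k · x₁^k.

Poly : ℕ → Set
Poly zero    = ℤ
Poly (suc ℓ) = List (Poly ℓ)

IsZeroPoly : ∀ {ℓ} → Poly ℓ → Set
IsZeroPoly {zero}  c  = c ≡ + 0
IsZeroPoly {suc ℓ} cs = All IsZeroPoly cs

eval : ∀ {ℓ} → Poly ℓ → Vec ℤ ℓ → ℤ
eval {zero}  c  []       = c
eval {suc ℓ} cs (x ∷ xs) = foldr (λ c acc → eval c xs ℤ.+ x ℤ.* acc) (+ 0) cs

scale : ∀ {ℓ} → ℤ → Poly ℓ → Poly ℓ
scale {zero}  k c  = k ℤ.* c
scale {suc ℓ} k cs = map (scale k) cs

private
  dgo : ∀ {ℓ} → ℕ → List (Poly ℓ) → List (Poly ℓ)
  dgo k []       = []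
  dgo k (c ∷ cs) = scale (+ k) c ∷ dgo (suc k) cs

d₁ : ∀ {ℓ} → List (Poly ℓ) → List (Poly ℓ)
d₁ []       = []
d₁ (_ ∷ cs) = dgo 1 cs

iter : ∀ {A : Set} → ℕ → (A → A) → A → A
iter zero    f a = a
iter (suc n) f a = f (iter n f a)

deriv : ∀ {ℓ} → Vec ℕ ℓ → Poly ℓ → Poly ℓ
deriv {zero}  []       c  = c
deriv {suc ℓ} (i ∷ is) cs = map (deriv is) (iter i d₁ cs)

∣_∣ᵢ : ∀ {ℓ} → Vec ℕ ℓ → ℕ
∣ is ∣ᵢ = Vec.sum is

-- p-adic integers as coherent sequences of residues: res j represents
-- the class modulo p^j, and res (j+1) ≡ res j (mod p^j).

record ℤ[_] (p : ℕ) : Set where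
  field
    res : ℕ → ℤ
    coh : ∀ j → (+ (p ℕ.^ j)) ∣ (res (suc j) - res j)
open ℤ[_] public

_≡_[mod_] : ℤ → ℤ → ℕ → Set
a ≡ b [mod n ] = (+ n) ∣ (a - b)

resVec : ∀ {p ℓ} → Vec ℤ[ p ] ℓ → ℕ → Vec ℤ ℓ
resVec z j = Vec.map (λ w → res w j) z

-- for an integer polynomial g and 𝐳 ∈ ℤ_p^ℓ, the p-adic integer g(𝐳) is
-- the coherent sequence j ↦ g(𝐳 mod p^j); it is 0 iff every residue is
-- divisible by p^j.
PadicValueZero : ∀ {ℓ} (p : ℕ) → Poly ℓ → Vec ℤ[ p ] ℓ → Set
PadicValueZero p g z = ∀ j → (+ (p ℕ.^ j)) ∣ eval g (resVec z j)

IsIntersectiveWith : ∀ {ℓ} → Poly ℓ → ((p : ℕ) → Vec ℤ[ p ] ℓ) → Set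
IsIntersectiveWith h z =
  ¬ IsZeroPoly h × (∀ p → Prime p → PadicValueZero p h (z p))

IsVanishingOrder : ∀ {ℓ} → Poly ℓ → ((p : ℕ) → Vec ℤ[ p ] ℓ) → (ℕ → ℕ) → Set
IsVanishingOrder {ℓ} h z m = ∀ p → Prime p →
  (Σ (Vec ℕ ℓ) λ i → ∣ i ∣ᵢ ≡ m p × ¬ PadicValueZero p (deriv i h) (z p))
  × (∀ (i : Vec ℕ ℓ) → ∣ i ∣ᵢ ℕ.< m p → PadicValueZero p (deriv i h) (z p))

IsLambda : (ℕ → ℕ) → (ℕ → ℕ) → Set
IsLambda m λ′ =
  λ′ 1 ≡ 1 × (∀ a b → λ′ (a ℕ.* b) ≡ λ′ a ℕ.* λ′ b)
  × (∀ p → Prime p → λ′ p ≡ p ℕ.^ m p)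

IsRVec : ∀ {ℓ} → ((p : ℕ) → Vec ℤ[ p ] ℓ) → (ℕ → Vec ℤ ℓ) → Set
IsRVec {ℓ} z r = ∀ d → 1 ℕ.≤ d →
  VAll.All (λ c → ℤ.- (+ d) ℤ.< c × c ℤ.≤ + 0) (r d)
  × (∀ p j → Prime p → (p ℕ.^ j) ℕD.∣ d →
       VAll.All (λ ab → proj₁ ab ≡ proj₂ ab [mod p ℕ.^ j ])
         (Vec.zip (r d) (resVec (z p) j)))

-- h_d(𝐱) = h(r_d + d𝐱)/λ(d).  For n ∈ ℤ, "n ∈ h_d(ℤ^ℓ)" means
-- h(r_d + d𝐱) = λ(d)·n for some 𝐱 ∈ ℤ^ℓ  (λ(d) ≠ 0).

shiftVec : ∀ {ℓ} → Vec ℤ ℓ → ℕ → Vec ℤ ℓ → Vec ℤ ℓ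
shiftVec r d x = Vec.zipWith ℤ._+_ r (Vec.map (λ c → + d ℤ.* c) x)

InImage : ∀ {ℓ} → Poly ℓ → (ℕ → Vec ℤ ℓ) → (ℕ → ℕ) → ℕ → ℤ → Set
InImage {ℓ} h r λ′ d n =
  Σ (Vec ℤ ℓ) λ x → eval h (shiftVec (r d) d x) ≡ + (λ′ d) ℤ.* n

DiffAvoids : ∀ {ℓ} → (ℕ → Set) → Poly ℓ → (ℕ → Vec ℤ ℓ) → (ℕ → ℕ) → ℕ → Set
DiffAvoids A h r λ′ d =
  ∀ a b → A a → A b → InImage h r λ′ d (+ a - + b) → + a - + b ≡ + 0

{-# OPTIONS --safe #-}
-- Since r_{qd} ≡ z_p ≡ r_d (mod p^j) for every prime power p^j ∣ d, the two
-- residue vectors are congruent modulo d, so r_{qd} + qd𝐱 = r_d + d𝐲 for an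
-- integer vector 𝐲.  As λ is multiplicative this gives λ(q)·h_{qd}(𝐱) = h_d(𝐲).
-- If a, b ∈ A′ with a − b ∈ h_{qd}(ℤ^ℓ), then (x + λ(q)a) − (x + λ(q)b) is a
-- difference of elements of A lying in h_d(ℤ^ℓ), hence 0; and λ(q) ≠ 0.
module Submission where

open import Defs
open import Data.Nat using (ℕ; _≤_; _*_)
open import Data.Integer using (ℤ; +_) renaming (_+_ to _+ℤ_; _*_ to _*ℤ_)
open import Data.Vec using (Vec)
open import Data.Product using (Σ; _×_)
open import Relation.Binary.PropositionalEquality using (_≡_)

open import Data.Nat using (zero; suc; NonZero; _^_; _≟_; ≢-nonZero⁻¹; >-nonZero)
open import Data.Nat.Properties using (*-comm; *-identityʳ; *-mono-≤; m*n≡0⇒m≡0∨n≡0; m^n≢0)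
open import Data.Nat.Divisibility
  using (divides; ∣1⇒≡1; 1∣_; n∣m*n; m∣m*n; ∣-trans; *-monoʳ-∣; *-cancelˡ-∣)
  renaming (_∣_ to _∣ℕ_)
open import Data.Nat.Primality using (Prime; ¬prime[1]; euclidsLemma; prime⇒irreducible; prime⇒nonZero)
open import Data.Nat.Primality.Factorisation using (factorise)
open import Data.Nat.Coprimality using (Coprime; coprime-divisor)
open import Data.Nat.ListAction using (product)
import Data.Integer as ℤ
open import Data.Integer.Properties using (∣i-j∣≡∣j-i∣; pos-*; i*j≡0⇒i≡0∨j≡0; +-injective)
import Data.Integer.Divisibility.Signed as Signed
open import Data.Integer.Tactic.RingSolver using (solve-∀)
open import Data.List using ([]; _∷_)
open import Data.List.Relation.Unary.All using (All; []; _∷_)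
import Data.Vec as Vec
open import Data.Vec.Properties using (lookup-zip)
open import Data.Vec.Relation.Unary.All.Properties using (lookup⁺)
import Data.Fin as Fin
open import Data.Product using (_,_; proj₁; proj₂)
open import Data.Sum using (inj₁; inj₂)
open import Data.Empty using (⊥-elim)
open import Function using (_∘_)
open import Relation.Nullary using (yes; no)
open import Relation.Binary.PropositionalEquality
  using (_≢_; refl; sym; trans; cong; cong₂; subst; module ≡-Reasoning)

private
  variable
    p q : ℕ

prime∣^⇒prime∣ : ∀ j → Prime p → p ∣ℕ q ^ j → p ∣ℕ q
prime∣^⇒prime∣ zero    pp p∣1 = ⊥-elim (¬prime[1] (subst Prime (∣1⇒≡1 p∣1) pp))
prime∣^⇒prime∣ {q = q} (suc j) pp p∣q*q^j with euclidsLemma q (q ^ j) pp p∣q*q^j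
... | inj₁ p∣q   = p∣q
... | inj₂ p∣q^j = prime∣^⇒prime∣ j pp p∣q^j

prime^-coprime : ∀ j → Prime p → Prime q → q ≢ p → Coprime (q ^ j) p
prime^-coprime j pp pq q≢p (i∣q^j , i∣p) with prime⇒irreducible pp i∣p
... | inj₁ i≡1 = i≡1
... | inj₂ refl with prime⇒irreducible pq (prime∣^⇒prime∣ j pp i∣q^j)
...   | inj₁ p≡1 = ⊥-elim (¬prime[1] (subst Prime p≡1 pp))
...   | inj₂ p≡q = ⊥-elim (q≢p (sym p≡q))

∣-from-prime-powers : ∀ d .{{_ : NonZero d}} n →
  (∀ p j → Prime p → p ^ j ∣ℕ d → p ^ j ∣ℕ n) → d ∣ℕ n
∣-from-prime-powers d n local with factorise d
... | record { factors = ps ; isFactorisation = d≡∏ps ; factorsPrime = primes } =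
  subst (_∣ℕ n) (sym d≡∏ps)
    (productOfPrimes∣ primes n (λ p j pp p^j∣∏ps → local p j pp (subst (p ^ j ∣ℕ_) (sym d≡∏ps) p^j∣∏ps)))
  where
  productOfPrimes∣ : ∀ {ps} → All Prime ps → ∀ n →
    (∀ p j → Prime p → p ^ j ∣ℕ product ps → p ^ j ∣ℕ n) → product ps ∣ℕ n
  productOfPrimes∣ []         n _     = 1∣ n
  productOfPrimes∣ {p ∷ ps} (pp ∷ primes) n local
    with subst (_∣ℕ n) (*-identityʳ p)
           (local p 1 pp (subst (_∣ℕ p * product ps) (sym (*-identityʳ p)) (m∣m*n (product ps))))
  ... | divides n′ refl =
    subst (p * product ps ∣ℕ_) (*-comm p n′) (*-monoʳ-∣ p (productOfPrimes∣ primes n′ local′))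
    where
    instance _ = prime⇒nonZero pp
    local′ : ∀ q j → Prime q → q ^ j ∣ℕ product ps → q ^ j ∣ℕ n′
    local′ q j pq q^j∣∏ps with q ≟ p
    ... | yes refl = *-cancelˡ-∣ p
          (subst (p * p ^ j ∣ℕ_) (*-comm n′ p) (local p (suc j) pp (*-monoʳ-∣ p q^j∣∏ps)))
    ... | no q≢p = coprime-divisor (prime^-coprime j pp pq q≢p)
          (subst (q ^ j ∣ℕ_) (*-comm n′ p) (local q j pq (∣-trans q^j∣∏ps (n∣m*n p))))

≡[mod]-from-prime-powers : ∀ d .{{_ : NonZero d}} a b →
  (∀ p j → Prime p → p ^ j ∣ℕ d → a ≡ b [mod p ^ j ]) → a ≡ b [mod d ]
≡[mod]-from-prime-powers d a b = ∣-from-prime-powers d ℤ.∣ a ℤ.- b ∣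

≡[mod]-sym : ∀ {a b n} → a ≡ b [mod n ] → b ≡ a [mod n ]
≡[mod]-sym {a} {b} = subst (_ ∣ℕ_) (∣i-j∣≡∣j-i∣ a b)

≡[mod]-trans : ∀ {a b c n} → a ≡ b [mod n ] → b ≡ c [mod n ] → a ≡ c [mod n ]
≡[mod]-trans {a} {b} {c} {n} a≡b b≡c = Signed.∣⇒∣ᵤ (subst (+ n Signed.∣_) (telescope a b c)
  (Signed.∣m∣n⇒∣m+n (Signed.∣ᵤ⇒∣ {i = a ℤ.- b} a≡b) (Signed.∣ᵤ⇒∣ {i = b ℤ.- c} b≡c)))
  where
  telescope : ∀ a b c → (a ℤ.- b) ℤ.+ (b ℤ.- c) ≡ a ℤ.- c
  telescope = solve-∀

λ≢0 : ∀ {m λ′} → IsLambda m λ′ → ∀ n .{{_ : NonZero n}} → λ′ n ≢ 0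
λ≢0 {m} {λ′} (λ1≡1 , λ-* , λ-prime) n with factorise n
... | record { factors = ps ; isFactorisation = n≡∏ps ; factorsPrime = primes } =
  subst (λ k → λ′ k ≢ 0) (sym n≡∏ps) (onProductOfPrimes primes)
  where
  onProductOfPrimes : ∀ {ps} → All Prime ps → λ′ (product ps) ≢ 0
  onProductOfPrimes [] λ1≡0 with trans (sym λ1≡1) λ1≡0
  ... | ()
  onProductOfPrimes {p ∷ ps} (pp ∷ primes) λ∏≡0
    with m*n≡0⇒m≡0∨n≡0 (λ′ p) (trans (sym (λ-* p (product ps))) λ∏≡0)
  ... | inj₁ λp≡0 = ≢-nonZero⁻¹ (p ^ m p) {{m^n≢0 p (m p) {{prime⇒nonZero pp}}}}
                      (trans (sym (λ-prime p pp)) λp≡0)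
  ... | inj₂ λ∏ps≡0 = onProductOfPrimes primes λ∏ps≡0

rVec-≡[mod] : ∀ {ℓ} (z : (p : ℕ) → Vec ℤ[ p ] ℓ) (r : ℕ → Vec ℤ ℓ) → IsRVec z r →
  ∀ {d e} → 1 ≤ d → 1 ≤ e → d ∣ℕ e →
  ∀ i → Vec.lookup (r e) i ≡ Vec.lookup (r d) i [mod d ]
rVec-≡[mod] z r isR {d} {e} 1≤d 1≤e d∣e i =
  ≡[mod]-from-prime-powers d {{>-nonZero 1≤d}} (Vec.lookup (r e) i) (Vec.lookup (r d) i) λ p j pp p^j∣d →
    ≡[mod]-trans {Vec.lookup (r e) i} {Vec.lookup (resVec (z p) j) i} {Vec.lookup (r d) i}
      (≡-root 1≤e p j pp (∣-trans p^j∣d d∣e))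
      (≡[mod]-sym {a = Vec.lookup (r d) i} (≡-root 1≤d p j pp p^j∣d))
  where
  ≡-root : ∀ {c} → 1 ≤ c → ∀ p j → Prime p → p ^ j ∣ℕ c →
    Vec.lookup (r c) i ≡ Vec.lookup (resVec (z p) j) i [mod p ^ j ]
  ≡-root {c} 1≤c p j pp p^j∣c =
    subst (λ ab → proj₁ ab ≡ proj₂ ab [mod p ^ j ]) (lookup-zip i (r c) (resVec (z p) j))
      (lookup⁺ (proj₂ (isR c 1≤c) p j pp p^j∣c) i)

shiftVec-coarsen : ∀ {ℓ} (u v x : Vec ℤ ℓ) d q →
  (∀ i → Vec.lookup u i ≡ Vec.lookup v i [mod d ]) →
  Σ (Vec ℤ ℓ) λ y → shiftVec v d y ≡ shiftVec u (q * d) x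
shiftVec-coarsen Vec.[] Vec.[] Vec.[] d q _ = Vec.[] , refl
shiftVec-coarsen (a Vec.∷ u) (b Vec.∷ v) (c Vec.∷ x) d q u≡v
  with Signed.∣ᵤ⇒∣ {i = a ℤ.- b} (u≡v Fin.zero) | shiftVec-coarsen u v x d q (u≡v ∘ Fin.suc)
... | Signed.divides k a-b≡kd | y , v+dy≡u+qdx = k ℤ.+ + q ℤ.* c Vec.∷ y , cong₂ Vec._∷_ head v+dy≡u+qdx
  where
  open ≡-Reasoning
  head : b ℤ.+ + d ℤ.* (k ℤ.+ + q ℤ.* c) ≡ a ℤ.+ + (q * d) ℤ.* c
  head = begin
    b ℤ.+ + d ℤ.* (k ℤ.+ + q ℤ.* c)           ≡⟨ expand b (+ d) k (+ q) c ⟩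
    b ℤ.+ k ℤ.* + d ℤ.+ (+ q ℤ.* + d) ℤ.* c   ≡⟨ cong (λ t → b ℤ.+ t ℤ.+ (+ q ℤ.* + d) ℤ.* c) a-b≡kd ⟨
    b ℤ.+ (a ℤ.- b) ℤ.+ (+ q ℤ.* + d) ℤ.* c   ≡⟨ cancel a b (+ q ℤ.* + d) c ⟩
    a ℤ.+ (+ q ℤ.* + d) ℤ.* c                 ≡⟨ cong (λ t → a ℤ.+ t ℤ.* c) (pos-* q d) ⟨
    a ℤ.+ + (q * d) ℤ.* c                     ∎
    where
    expand : ∀ b d k q c → b ℤ.+ d ℤ.* (k ℤ.+ q ℤ.* c) ≡ b ℤ.+ k ℤ.* d ℤ.+ (q ℤ.* d) ℤ.* c
    expand = solve-∀
    cancel : ∀ a b e c → b ℤ.+ (a ℤ.- b) ℤ.+ e ℤ.* c ≡ a ℤ.+ e ℤ.* c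
    cancel = solve-∀

InImage-coarsen : ∀ {ℓ} (h : Poly ℓ) (z : (p : ℕ) → Vec ℤ[ p ] ℓ) (m λ′ : ℕ → ℕ) (r : ℕ → Vec ℤ ℓ) →
  IsLambda m λ′ → IsRVec z r → ∀ d q → 1 ≤ d → 1 ≤ q →
  ∀ n → InImage h r λ′ (q * d) n → InImage h r λ′ d (+ λ′ q ℤ.* n)
InImage-coarsen h z m λ′ r (_ , λ-* , _) isR d q 1≤d 1≤q n (x , hx)
  with shiftVec-coarsen (r (q * d)) (r d) x d q
         (rVec-≡[mod] z r isR 1≤d (*-mono-≤ 1≤q 1≤d) (n∣m*n q))
... | y , r+dy≡r+qdx = y , (begin
  eval h (shiftVec (r d) d y)               ≡⟨ cong (eval h) r+dy≡r+qdx ⟩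
  eval h (shiftVec (r (q * d)) (q * d) x)   ≡⟨ hx ⟩
  + λ′ (q * d) ℤ.* n                        ≡⟨ cong (λ t → + t ℤ.* n) (λ-* q d) ⟩
  + (λ′ q * λ′ d) ℤ.* n                     ≡⟨ cong (ℤ._* n) (pos-* (λ′ q) (λ′ d)) ⟩
  + λ′ q ℤ.* + λ′ d ℤ.* n                   ≡⟨ swap (+ λ′ q) (+ λ′ d) n ⟩
  + λ′ d ℤ.* (+ λ′ q ℤ.* n)                 ∎)
  where
  open ≡-Reasoning
  swap : ∀ a b c → a ℤ.* b ℤ.* c ≡ b ℤ.* (a ℤ.* c)
  swap = solve-∀

proposition3p2 : (ℓ : ℕ) (h : Poly ℓ) (z : (p : ℕ) → Vec ℤ[ p ] ℓ)
    (m : ℕ → ℕ) (λ′ : ℕ → ℕ) (r : ℕ → Vec ℤ ℓ) →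
    IsIntersectiveWith h z → IsVanishingOrder h z m →
    IsLambda m λ′ → IsRVec z r →
    (d q : ℕ) → 1 ≤ d → 1 ≤ q →
    (A A′ : ℕ → Set) →
    DiffAvoids A h r λ′ d →
    (Σ ℤ λ x → ∀ a → A′ a → Σ ℕ λ n → (+ n ≡ x +ℤ (+ λ′ q) *ℤ (+ a)) × A n) →
    DiffAvoids A′ h r λ′ (q * d)
proposition3p2 ℓ h z m λ′ r _ _ isL isR d q 1≤d 1≤q A A′ A-avoids (x , embed) a b A′a A′b a-b∈img
  with embed a A′a | embed b A′b
... | nₐ , nₐ≡x+λa , Anₐ | n_b , n_b≡x+λb , An_b =
  λ[a-b]≡0⇒a-b≡0 (trans (sym nₐ-n_b≡λ[a-b]) (A-avoids nₐ n_b Anₐ An_b nₐ-n_b∈img))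
  where
  nₐ-n_b≡λ[a-b] : + nₐ ℤ.- + n_b ≡ + λ′ q ℤ.* (+ a ℤ.- + b)
  nₐ-n_b≡λ[a-b] = trans (cong₂ ℤ._-_ nₐ≡x+λa n_b≡x+λb) (cancel x (+ λ′ q) (+ a) (+ b))
    where
    cancel : ∀ x l a b → (x ℤ.+ l ℤ.* a) ℤ.- (x ℤ.+ l ℤ.* b) ≡ l ℤ.* (a ℤ.- b)
    cancel = solve-∀

  nₐ-n_b∈img : InImage h r λ′ d (+ nₐ ℤ.- + n_b)
  nₐ-n_b∈img = subst (InImage h r λ′ d) (sym nₐ-n_b≡λ[a-b])
    (InImage-coarsen h z m λ′ r isL isR d q 1≤d 1≤q (+ a ℤ.- + b) a-b∈img)

  λ[a-b]≡0⇒a-b≡0 : + λ′ q ℤ.* (+ a ℤ.- + b) ≡ + 0 → + a ℤ.- + b ≡ + 0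
  λ[a-b]≡0⇒a-b≡0 λ[a-b]≡0 with i*j≡0⇒i≡0∨j≡0 (+ λ′ q) λ[a-b]≡0
  ... | inj₁ λq≡0 = ⊥-elim (λ≢0 {m} {λ′} isL q {{>-nonZero 1≤q}} (+-injective λq≡0))
  ... | inj₂ a-b≡0 = a-b≡0
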